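{- Let $D=(V,A)$ be a digraph and $\mathcal{L}\subseteq 2^V$ a laminar family with $V\in\mathcal{L}$ and $\{v\}\in\mathcal{L}$ for every $v\in V$. For sets $X,Y\subseteq V$ we have $M_{D,\mathcal{L}}(X\cup Y)\subseteq M_{D,\mathcal{L}}(X)\cup M_{D,\mathcal{L}}(Y)$. Consequently, $f_{D,\mathcal{L}}(X)=f_{D,\mathcal{L}}(Y)=0$ implies $f_{D,\mathcal{L}}(X\cup Y)=0$.
   Context: For $Z\subseteq V$, $\mathcal{L}_Z=\{F\in\mathcal{L}:F\cap Z\ne\emptyset\}$, $M_{D,\mathcal{L}}(Z)=\delta^{in}_D(Z)\setminus\bigcup_{F\in\mathcal{L}_Z}\delta^{out}_D(F)$ and $f_{D,\mathcal{L}}(Z)=|M_{D,\mathcal{L}}(Z)|$. -}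

module Defs where

open import Data.Nat using (ℕ)
open import Data.Fin using (Fin)
open import Data.Bool using (_∧_; not)
open import Data.Vec using (tabulate; lookup)
open import Data.List using (List; filter)
open import Data.List.Membership.Propositional using (_∈_)
open import Data.Product using (_×_)
open import Data.Sum using (_⊎_)
open import Data.Fin.Subset using (Subset; _⊆_; _∩_; _─_; ⋃; Empty; ⊤; ⁅_⁆; ∣_∣)
open import Data.Fin.Subset.Properties using (nonempty?)

-- A (finite) digraph D = (V, A) with V = Fin n and A = Fin m;
-- each arc has a tail and a head (parallel arcs allowed).
record Digraph (n : ℕ) : Set where
  field
    m    : ℕ
    tail : Fin m → Fin n
    head : Fin m → Fin n
open Digraph public

δin : ∀ {n} (D : Digraph n) → Subset n → Subset (m D)
δin D Z = tabulate λ a → lookup Z (head D a) ∧ not (lookup Z (tail D a))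

δout : ∀ {n} (D : Digraph n) → Subset n → Subset (m D)
δout D Z = tabulate λ a → lookup Z (tail D a) ∧ not (lookup Z (head D a))

Laminar : ∀ {n} → List (Subset n) → Set
Laminar ℒ = ∀ {F G} → F ∈ ℒ → G ∈ ℒ → (F ⊆ G) ⊎ ((G ⊆ F) ⊎ Empty (F ∩ G))

ℒ[_] : ∀ {n} → List (Subset n) → Subset n → List (Subset n)
ℒ[ ℒ ] Z = filter (λ F → nonempty? (F ∩ Z)) ℒ

M : ∀ {n} (D : Digraph n) → List (Subset n) → Subset n → Subset (m D)
M D ℒ Z = δin D Z ─ ⋃ (Data.List.map (δout D) (ℒ[ ℒ ] Z))

f : ∀ {n} (D : Digraph n) → List (Subset n) → Subset n → ℕ
f D ℒ Z = ∣ M D ℒ Z ∣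

-- An arc a entering X ∪ Y has its head in X, say, and its tail outside X ∪ Y, so it enters X.
-- Every F ∈ ℒ meeting X also meets X ∪ Y, so ℒ_X ⊆ ℒ_{X ∪ Y}: an arc leaving no member of
-- ℒ_{X ∪ Y} leaves no member of ℒ_X either, and a ∈ M(X).
module Submission where

open import Defs
open import Data.Bool using (Bool; true; false; _∧_; not)
open import Data.Bool.Properties using (¬-not)
open import Data.Nat using (ℕ)
open import Data.Nat.Properties using (n≤0⇒n≡0; module ≤-Reasoning)
open import Data.Fin using (Fin)
open import Data.List using (List; []; _∷_; map)
open import Data.List.Membership.Propositional using () renaming (_∈_ to _∈ˡ_)
open import Data.List.Membership.Propositional.Properties using (∈-map⁺; ∈-filter⁺; ∈-filter⁻)
open import Data.List.Relation.Unary.Any as Any using ()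
open import Data.Product using (_×_; _,_; proj₁)
open import Data.Sum using (inj₁; inj₂)
open import Data.Vec using ([]; _∷_; lookup; tabulate)
open import Data.Vec.Base using (here; there)
open import Data.Vec.Properties using (lookup∘tabulate; []=⇒lookup; lookup⇒[]=)
open import Data.Fin.Subset
  using (Subset; _∈_; _∉_; _⊆_; _∪_; _∩_; _─_; ⋃; Nonempty; ⊤; ⊥; ⁅_⁆; ∣_∣; inside; outside)
open import Data.Fin.Subset.Properties
  using (nonempty?; ∉⊥; x∈p∪q⁻; x∈p∪q⁺; x∈p∩q⁻; x∈p∩q⁺; x∈p∧x∉q⇒x∈p─q; p─q⊆p;
         p⊆q⇒∣p∣≤∣q∣; p⊆p∪q; q⊆p∪q; ∪-identityˡ; ∣⊥∣≡0)
open import Function using (_∘_)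
open import Relation.Nullary using (contradiction)
open import Relation.Binary.PropositionalEquality using (_≡_; refl; sym; trans; cong; cong₂)

private
  variable
    n : ℕ
    x : Fin n
    p q : Subset n

∧-not≡true⁻ : ∀ {b c : Bool} → b ∧ not c ≡ true → b ≡ true × c ≡ false
∧-not≡true⁻ {true} {false} refl = refl , refl

lookup≡false⇒∉ : lookup p x ≡ false → x ∉ p
lookup≡false⇒∉ e x∈p with trans (sym ([]=⇒lookup x∈p)) e
... | ()

∈-tabulate⁻ : ∀ {g : Fin n → Bool} → x ∈ tabulate g → g x ≡ true
∈-tabulate⁻ {x = x} {g} x∈ = trans (sym (lookup∘tabulate g x)) ([]=⇒lookup x∈)

∈-tabulate⁺ : ∀ {g : Fin n → Bool} → g x ≡ true → x ∈ tabulate g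
∈-tabulate⁺ {x = x} {g} e = lookup⇒[]= x (tabulate g) (trans (lookup∘tabulate g x) e)

x∈p─q⇒x∉q : ∀ (p q : Subset n) → x ∈ p ─ q → x ∉ q
x∈p─q⇒x∉q (_ ∷ p) (outside ∷ q) here = λ ()
x∈p─q⇒x∉q (_ ∷ p) (_ ∷ q) (there x∈p─q) (there x∈q) = x∈p─q⇒x∉q p q x∈p─q x∈q

∣p∣≡0⇒p≡⊥ : ∀ (p : Subset n) → ∣ p ∣ ≡ 0 → p ≡ ⊥
∣p∣≡0⇒p≡⊥ []            _ = refl
∣p∣≡0⇒p≡⊥ (outside ∷ p) e = cong (outside ∷_) (∣p∣≡0⇒p≡⊥ p e)

x∈⋃⁺ : ∀ {ps : List (Subset n)} → p ∈ˡ ps → x ∈ p → x ∈ ⋃ ps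
x∈⋃⁺ (Any.here refl) x∈p = p⊆p∪q _ x∈p
x∈⋃⁺ {ps = q ∷ _} (Any.there p∈ps) x∈p = q⊆p∪q q _ (x∈⋃⁺ p∈ps x∈p)

⋃-map-mono : ∀ {A : Set} (g : A → Subset n) {xs ys : List A}
           → (∀ {a} → a ∈ˡ xs → a ∈ˡ ys) → ⋃ (map g xs) ⊆ ⋃ (map g ys)
⋃-map-mono g {[]} _ x∈⊥ = contradiction x∈⊥ ∉⊥
⋃-map-mono g {a ∷ xs} xs⊆ys x∈ with x∈p∪q⁻ (g a) _ x∈
... | inj₁ x∈ga   = x∈⋃⁺ (∈-map⁺ g (xs⊆ys (Any.here refl))) x∈ga
... | inj₂ x∈rest = ⋃-map-mono g (xs⊆ys ∘ Any.there) x∈rest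

Nonempty-∩-monoʳ : ∀ (r : Subset n) → p ⊆ q → Nonempty (r ∩ p) → Nonempty (r ∩ q)
Nonempty-∩-monoʳ r p⊆q (v , v∈r∩p) with x∈p∩q⁻ r _ v∈r∩p
... | v∈r , v∈p = v , x∈p∩q⁺ (v∈r , p⊆q v∈p)

ℒ[]-mono : ∀ (ℒ : List (Subset n)) {Z W F} → Z ⊆ W → F ∈ˡ ℒ[ ℒ ] Z → F ∈ˡ ℒ[ ℒ ] W
ℒ[]-mono ℒ {Z} {W} Z⊆W F∈ℒZ with ∈-filter⁻ (λ F → nonempty? (F ∩ Z)) {xs = ℒ} F∈ℒZ
... | F∈ℒ , F∩Z≠∅ = ∈-filter⁺ (λ F → nonempty? (F ∩ W)) F∈ℒ (Nonempty-∩-monoʳ _ Z⊆W F∩Z≠∅)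

module _ (D : Digraph n) where

  ∈δin⁻ : ∀ {Z a} → a ∈ δin D Z → head D a ∈ Z × tail D a ∉ Z
  ∈δin⁻ {Z} {a} a∈δin with ∧-not≡true⁻ (∈-tabulate⁻ a∈δin)
  ... | head∈ , tail∉ = lookup⇒[]= (head D a) Z head∈ , lookup≡false⇒∉ tail∉

  ∈δin⁺ : ∀ {Z a} → head D a ∈ Z → tail D a ∉ Z → a ∈ δin D Z
  ∈δin⁺ {Z} {a} head∈ tail∉ =
    ∈-tabulate⁺ (cong₂ (λ b c → b ∧ not c) ([]=⇒lookup head∈) (¬-not (tail∉ ∘ lookup⇒[]= _ Z)))

  ∈M-shrink : ∀ (ℒ : List (Subset n)) {Z W a}
            → Z ⊆ W → a ∈ M D ℒ W → head D a ∈ Z → a ∈ M D ℒ Z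
  ∈M-shrink ℒ Z⊆W a∈MW head∈Z with ∈δin⁻ (p─q⊆p _ _ a∈MW)
  ... | _ , tail∉W =
    x∈p∧x∉q⇒x∈p─q (∈δin⁺ head∈Z (tail∉W ∘ Z⊆W))
                  (x∈p─q⇒x∉q _ _ a∈MW ∘ ⋃-map-mono (δout D) (ℒ[]-mono ℒ Z⊆W))

  M-∪-⊆ : ∀ (ℒ : List (Subset n)) X Y → M D ℒ (X ∪ Y) ⊆ M D ℒ X ∪ M D ℒ Y
  M-∪-⊆ ℒ X Y a∈M with x∈p∪q⁻ X Y (proj₁ (∈δin⁻ (p─q⊆p _ _ a∈M)))
  ... | inj₁ head∈X = x∈p∪q⁺ (inj₁ (∈M-shrink ℒ (p⊆p∪q Y) a∈M head∈X))
  ... | inj₂ head∈Y = x∈p∪q⁺ (inj₂ (∈M-shrink ℒ (q⊆p∪q X Y) a∈M head∈Y))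

  f-∪-zero : ∀ (ℒ : List (Subset n)) X Y → f D ℒ X ≡ 0 → f D ℒ Y ≡ 0 → f D ℒ (X ∪ Y) ≡ 0
  f-∪-zero ℒ X Y fX≡0 fY≡0 = n≤0⇒n≡0 (begin
    ∣ M D ℒ (X ∪ Y) ∣          ≤⟨ p⊆q⇒∣p∣≤∣q∣ (M-∪-⊆ ℒ X Y) ⟩
    ∣ M D ℒ X ∪ M D ℒ Y ∣      ≡⟨ cong₂ (λ p q → ∣ p ∪ q ∣) (∣p∣≡0⇒p≡⊥ (M D ℒ X) fX≡0)
                                                            (∣p∣≡0⇒p≡⊥ (M D ℒ Y) fY≡0) ⟩
    ∣ ∅ ∪ ∅ ∣                  ≡⟨ cong ∣_∣ (∪-identityˡ ∅) ⟩
    ∣ ∅ ∣                      ≡⟨ ∣⊥∣≡0 (m D) ⟩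
    0                          ∎)
    where
    open ≤-Reasoning
    ∅ : Subset (m D)
    ∅ = ⊥

claim8 : ∀ {n} (D : Digraph n) (ℒ : List (Subset n))
         → Laminar ℒ → ⊤ ∈ˡ ℒ → (∀ (v : Fin n) → ⁅ v ⁆ ∈ˡ ℒ)
         → (∀ (X Y : Subset n) → M D ℒ (X ∪ Y) ⊆ M D ℒ X ∪ M D ℒ Y)
           × (∀ (X Y : Subset n) → f D ℒ X ≡ 0 → f D ℒ Y ≡ 0 → f D ℒ (X ∪ Y) ≡ 0)
claim8 D ℒ _ _ _ = M-∪-⊆ D ℒ , f-∪-zero D ℒ
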